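{- Let $G=(V,E)$ be a graph, $k\ge 1$, and let $v\in V$ be large-sparse. Let $B\subseteq V\setminus\{v\}$ with $|B|\le 2k$ be such that $G-B$ contains no cycle passing through $v$. Let $\mathcal{C}_{\mathrm{nontree}}$ be the family of connected components of $G-v-B$ that are adjacent to $v$ and are not trees. If $|\mathcal{C}_{\mathrm{nontree}}|\ge k+1$, then $(G,k)$ is a yes-instance of \textsc{Cliques or Trees Vertex Deletion} if and only if $(G-v,k-1)$ is a yes-instance.
   Context: Graphs are undirected, without self-loops, possibly with multi-edges (a pair of parallel edges forms a cycle). $N(v)$ is the neighbor set; $\rho(v)$ is the number of unordered pairs of neighbors of $v$ that are adjacent (parallel edges counted once). A vertex $v$ is large-sparse if $|N(v)|>7k$ and $\rho(v)\le |N(v)|(|N(v)|-1)/4$. \textsc{Cliques or Trees Vertex Deletion}: given $(G,k)$, decide whether there is $X\subseteq V$ with $|X|\le k$ such that every component of $G-X$ is a clique (exactly one edge between any two distinct vertices) or a tree (connected, acyclic). -}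

module Defs where

open import Data.Nat using (ℕ; zero; suc; _+_; _*_; _∸_; _≤_; _<_; _<ᵇ_)
open import Data.Bool using (Bool; true; false; _∧_; if_then_else_)
open import Data.Fin using (Fin; toℕ)
open import Data.Fin.Subset using (Subset; _∈_; _∉_; _⊆_; ∣_∣; _─_)
open import Data.Vec using (tabulate)
open import Data.List using (List; []; _∷_; _∷ʳ_; length; map; allFin)
open import Data.Nat.ListAction using (sum)
open import Data.List.Relation.Unary.All using (All)
open import Data.List.Relation.Unary.Linked using (Linked)
open import Data.List.Relation.Unary.Unique.Propositional using (Unique)
open import Data.Product using (Σ; ∃; _×_; _,_)
open import Data.Sum using (_⊎_)
open import Relation.Binary.PropositionalEquality using (_≡_; _≢_)
open import Relation.Nullary using (¬_)

-- A finite multigraph on vertex set Fin n: mult u v = number of parallel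
-- edges between u and v; symmetric, no self-loops.
record Graph (n : ℕ) : Set where
  field
    mult  : Fin n → Fin n → ℕ
    sym   : ∀ u v → mult u v ≡ mult v u
    loopless : ∀ v → mult v v ≡ 0
open Graph public

module _ {n : ℕ} (G : Graph n) where

  Adj : Fin n → Fin n → Set
  Adj u v = 1 ≤ mult G u v

  adjᵇ : Fin n → Fin n → Bool
  adjᵇ u v = 0 <ᵇ mult G u v

  N : Fin n → Subset n
  N v = tabulate (λ u → adjᵇ v u)

  deg : Fin n → ℕ
  deg v = ∣ N v ∣

  -- ρ(v): number of unordered pairs {a,b} (a ≠ b, counted once via toℕ a < toℕ b)
  -- of neighbours of v that are adjacent (parallel edges counted once)
  ρ : Fin n → ℕ
  ρ v = sum (map (λ a → ∣ tabulate (λ b →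
          (toℕ a <ᵇ toℕ b) ∧ adjᵇ v a ∧ adjᵇ v b ∧ adjᵇ a b) ∣) (allFin n))

  -- large-sparse: |N(v)| > 7k and ρ(v) ≤ |N(v)|(|N(v)|-1)/4
  -- (the latter written without division as 4ρ(v) ≤ |N(v)|(|N(v)|-1))
  LargeSparse : ℕ → Fin n → Set
  LargeSparse k v = 7 * k < deg v × 4 * ρ v ≤ deg v * (deg v ∸ 1)

  data Reach (S : Subset n) : Fin n → Fin n → Set where
    here : ∀ {x} → x ∈ S → Reach S x x
    step : ∀ {x y z} → x ∈ S → Adj x y → Reach S y z → Reach S x z

  Component : Subset n → Subset n → Set
  Component S C = Σ (Fin n) λ x → x ∈ S × (∀ y → (y ∈ C → Reach S x y) × (Reach S x y → y ∈ C))

  -- a cycle in G[S], given by its distinct vertices x ∷ xs in cyclic order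
  -- (at least 2 vertices; a 2-cycle requires a pair of parallel edges)
  record CycleIn (S : Subset n) (x : Fin n) (xs : List (Fin n)) : Set where
    field
      nontrivial : 1 ≤ length xs
      distinct   : Unique (x ∷ xs)
      inside     : All (_∈ S) (x ∷ xs)
      closedWalk : Linked Adj ((x ∷ xs) ∷ʳ x)
      twoCycle   : ∀ y → xs ≡ y ∷ [] → 2 ≤ mult G x y

  -- a component C is a tree: (connected, by being a component, and) acyclic
  IsTree : Subset n → Set
  IsTree C = ∀ x xs → ¬ CycleIn C x xs

  IsClique : Subset n → Set
  IsClique C = ∀ x y → x ∈ C → y ∈ C → x ≢ y → mult G x y ≡ 1

  YesInstance : Subset n → ℕ → Set
  YesInstance S k = ∃ λ X → X ⊆ S × ∣ X ∣ ≤ k ×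
    (∀ C → Component (S ─ X) C → IsClique C ⊎ IsTree C)

{-# OPTIONS --safe #-}
-- If a solution X of (G, k) avoided v, then, the k + 1 non-tree components
-- being pairwise disjoint, one of them, C, would miss X. Then C and v lie in
-- a single component of G - X, which contains the cycles of C and so must be
-- a clique; but v together with two vertices of C would then span a triangle
-- through v avoiding B. Hence every solution contains v, and solutions of
-- (G, k) containing v are exactly solutions of (G - v, k - 1) plus v.
module Submission where

open import Defs
open import Data.Nat using (ℕ; suc; _*_; _∸_; _≤_)
open import Data.Fin using (Fin)
open import Data.Fin.Subset using (Subset; _∈_; _∉_; ∁; ⊤; ⁅_⁆; _∪_; ∣_∣; _-_)
open import Data.List using (List; _∷_)
open import Data.List.Membership.Propositional using () renaming (_∉_ to _∉ₗ_)
open import Data.Product using (Σ; _×_)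
open import Relation.Binary.PropositionalEquality using (_≡_)
open import Relation.Nullary using (¬_)
open import Function.Definitions using (Injective)
open import Function.Bundles using (_⇔_)

open import Level using (Level)
open import Data.Bool using (true; false)
open import Data.Bool.Properties using (T-≡)
open import Data.Empty using (⊥-elim)
open import Data.Fin using (zero; suc; _≟_)
open import Data.Fin.Properties using (any?; suc-injective; 0≢1+n)
open import Data.Fin.Subset using (_─_; _⊆_; _∩_; Nonempty; Empty)
open import Data.Fin.Subset.Properties
open import Data.List using ([])
open import Data.List.Relation.Unary.All using (All; []; _∷_) renaming (map to All-map)
open import Data.List.Relation.Unary.AllPairs using ([]; _∷_)
open import Data.List.Relation.Unary.Any using (here)
open import Data.List.Relation.Unary.Linked using ([-]; _∷_)
open import Data.Nat using (zero; _+_; _<_; z≤n; s≤s; _≤?_)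
open import Data.Nat.Properties using (≤-trans; ≤-reflexive; <-≤-trans; ≤-pred; <⇒≱; +-suc; m≤n⇒m≤1+n; module ≤-Reasoning)
open import Data.Product using (_,_; proj₁; proj₂; ∃)
open import Data.Sum using (_⊎_; inj₁; inj₂; [_,_]; map₂)
open import Data.Vec using ([]; _∷_; tabulate; there)
open import Data.Vec.Properties using (lookup∘tabulate; []=⇒lookup; lookup⇒[]=)
open import Function using (_∘_)
open import Function.Bundles using (mk⇔; module Equivalence)
import Relation.Binary.PropositionalEquality as ≡
open ≡ using (_≢_; refl; cong; subst; ≢-sym; module ≡-Reasoning)
open import Relation.Nullary using (Dec; yes; no; ¬?; contradiction)
open import Relation.Nullary.Decidable using (isYes; map′; _×-dec_; _⊎-dec_; toSum; toWitness; fromWitness; decidable-stable)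
open import Relation.Unary using (Pred; Decidable)

private
  variable
    ℓ : Level
    m n : ℕ

x∈p─q⇒x∉q : ∀ {x : Fin n} (p q : Subset n) → x ∈ p ─ q → x ∉ q
x∈p─q⇒x∉q (_ ∷ p) (false ∷ q) (there x∈p─q) (there x∈q) = x∈p─q⇒x∉q p q x∈p─q x∈q
x∈p─q⇒x∉q (_ ∷ p) (true  ∷ q) (there x∈p─q) (there x∈q) = x∈p─q⇒x∉q p q x∈p─q x∈q

─-monoˡ : ∀ {p q : Subset n} (r : Subset n) → p ⊆ q → p ─ r ⊆ q ─ r
─-monoˡ {p = p} r p⊆q x∈p─r = x∈p∧x∉q⇒x∈p─q (p⊆q (p─q⊆p p r x∈p─r)) (x∈p─q⇒x∉q p r x∈p─r)

x∈p⇒⁅x⁆⊆p : ∀ {x : Fin n} {p} → x ∈ p → ⁅ x ⁆ ⊆ p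
x∈p⇒⁅x⁆⊆p {x = x} {p} x∈p y∈⁅x⁆ = subst (_∈ p) (≡.sym (x∈⁅y⁆⇒x≡y x y∈⁅x⁆)) x∈p

p⊆q⇒p∪[q─p]≡q : ∀ {p q : Subset n} → p ⊆ q → p ∪ (q ─ p) ≡ q
p⊆q⇒p∪[q─p]≡q {p = p} {q} p⊆q = ⊆-antisym
  (λ x∈ → [ p⊆q , p─q⊆p q p ] (x∈p∪q⁻ p (q ─ p) x∈))
  (λ {x} x∈q → x∈p∪q⁺ (map₂ (x∈p∧x∉q⇒x∈p─q x∈q) (toSum (x ∈? p))))

∣p∪q∣≤∣p∣+∣q∣ : (p q : Subset n) → ∣ p ∪ q ∣ ≤ ∣ p ∣ + ∣ q ∣
∣p∪q∣≤∣p∣+∣q∣ []          []          = z≤n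
∣p∪q∣≤∣p∣+∣q∣ (true  ∷ p) (true  ∷ q) =
  s≤s (≤-trans (m≤n⇒m≤1+n (∣p∪q∣≤∣p∣+∣q∣ p q)) (≤-reflexive (≡.sym (+-suc ∣ p ∣ ∣ q ∣))))
∣p∪q∣≤∣p∣+∣q∣ (true  ∷ p) (false ∷ q) = s≤s (∣p∪q∣≤∣p∣+∣q∣ p q)
∣p∪q∣≤∣p∣+∣q∣ (false ∷ p) (true  ∷ q) =
  ≤-trans (s≤s (∣p∪q∣≤∣p∣+∣q∣ p q)) (≤-reflexive (≡.sym (+-suc ∣ p ∣ ∣ q ∣)))
∣p∪q∣≤∣p∣+∣q∣ (false ∷ p) (false ∷ q) = ∣p∪q∣≤∣p∣+∣q∣ p q

select : {P : Pred (Fin n) ℓ} → Decidable P → Subset n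
select P? = tabulate (isYes ∘ P?)

∈-select : {P : Pred (Fin n) ℓ} (P? : Decidable P) {x : Fin n} → x ∈ select P? ⇔ P x
∈-select P? {x} = mk⇔
  (λ x∈ → toWitness (Equivalence.from T-≡ (≡.trans (≡.sym (lookup∘tabulate _ x)) ([]=⇒lookup x∈))))
  (λ Px → lookup⇒[]= x _ (≡.trans (lookup∘tabulate _ x) (Equivalence.to T-≡ (fromWitness Px))))

injection⇒≤∣∣ : (f : Fin m → Fin n) → Injective _≡_ _≡_ f → {X : Subset n} → (∀ i → f i ∈ X) → m ≤ ∣ X ∣
injection⇒≤∣∣ {zero}  f f-inj f∈X = z≤n
injection⇒≤∣∣ {suc m} f f-inj {X} f∈X =
  ≤-trans (s≤s (injection⇒≤∣∣ (f ∘ suc) (suc-injective ∘ f-inj) f∘suc∈X-f0)) (x∈p⇒∣p-x∣<∣p∣ (f∈X zero))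
  where
  f∘suc∈X-f0 : ∀ i → f (suc i) ∈ X - f zero
  f∘suc∈X-f0 i = x∈p∧x≢y⇒x∈p-y (f∈X (suc i)) (λ e → 0≢1+n (≡.sym (f-inj e)))

disjoint-family⇒∃-missed : (Cs : Fin m → Subset n) → (∀ {i j x} → x ∈ Cs i → x ∈ Cs j → i ≡ j) →
                           {X : Subset n} → ∣ X ∣ < m → ∃ λ i → Empty (Cs i ∩ X)
disjoint-family⇒∃-missed Cs disjoint {X} |X|<m with any? (λ i → ¬? (nonempty? (Cs i ∩ X)))
... | yes missed = missed
... | no ¬missed = contradiction (injection⇒≤∣∣ pick pick-injective (proj₂ ∘ pick∈)) (<⇒≱ |X|<m)
  where
  meets : ∀ i → Nonempty (Cs i ∩ X)
  meets i = decidable-stable (nonempty? _) (¬missed ∘ (i ,_))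
  pick : Fin _ → Fin _
  pick = proj₁ ∘ meets
  pick∈ : ∀ i → pick i ∈ Cs i × pick i ∈ X
  pick∈ i = x∈p∩q⁻ (Cs i) X (proj₂ (meets i))
  pick-injective : Injective _≡_ _≡_ pick
  pick-injective {i} {j} e = disjoint (proj₁ (pick∈ i)) (subst (_∈ Cs j) (≡.sym e) (proj₁ (pick∈ j)))

module _ (G : Graph n) where

  private
    variable
      S T C D : Subset n
      x y z : Fin n
      xs : List (Fin n)

  Adj-sym : Adj G x y → Adj G y x
  Adj-sym {x} {y} = subst (1 ≤_) (sym G x y)

  Reach-start : Reach G S x y → x ∈ S
  Reach-start (here x∈S)     = x∈S
  Reach-start (step x∈S _ _) = x∈S

  Reach-end : Reach G S x y → y ∈ S
  Reach-end (here y∈S)   = y∈S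
  Reach-end (step _ _ r) = Reach-end r

  Reach-trans : Reach G S x y → Reach G S y z → Reach G S x z
  Reach-trans (here _)       r′ = r′
  Reach-trans (step x∈S a r) r′ = step x∈S a (Reach-trans r r′)

  Reach-sym : Reach G S x y → Reach G S y x
  Reach-sym (here x∈S)     = here x∈S
  Reach-sym (step x∈S a r) = Reach-trans (Reach-sym r) (step (Reach-start r) (Adj-sym a) (here x∈S))

  Reach-restrict : (∀ {z} → Reach G S x z → z ∈ T) → Reach G S x y → Reach G T x y
  Reach-restrict inT (here x∈S)     = here (inT (here x∈S))
  Reach-restrict inT (step x∈S a r) = step (inT (here x∈S)) a (Reach-restrict (inT ∘ step x∈S a) r)

  Reach-mono : S ⊆ T → Reach G S x y → Reach G T x y
  Reach-mono S⊆T = Reach-restrict (S⊆T ∘ Reach-end)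

  ReachOnce : Subset n → Fin n → Fin n → Set
  ReachOnce S x y = x ≡ y ⊎ ∃ λ z → Adj G x z × Reach G (S - x) z y

  Reach⇒avoiding⊎ReachOnce : ∀ x → Reach G S z y → Reach G (S - x) z y ⊎ ReachOnce S x y
  Reach⇒avoiding⊎ReachOnce {z = z} x (here z∈S) with z ≟ x
  ... | yes refl = inj₂ (inj₁ refl)
  ... | no z≢x   = inj₁ (here (x∈p∧x≢y⇒x∈p-y z∈S z≢x))
  Reach⇒avoiding⊎ReachOnce {z = z} x (step z∈S a r) with Reach⇒avoiding⊎ReachOnce x r
  ... | inj₂ once = inj₂ once
  ... | inj₁ r′ with z ≟ x
  ...   | yes refl = inj₂ (inj₂ (_ , a , r′))
  ...   | no z≢x   = inj₁ (step (x∈p∧x≢y⇒x∈p-y z∈S z≢x) a r′)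

  Reach⇒ReachOnce : Reach G S x y → ReachOnce S x y
  Reach⇒ReachOnce {S} {x} r = [ ⊥-elim ∘ x∉S-x ∘ Reach-start , (λ once → once) ] (Reach⇒avoiding⊎ReachOnce x r)
    where
    x∉S-x : x ∉ S - x
    x∉S-x x∈S-x = x∈p─q⇒x∉q S ⁅ x ⁆ x∈S-x (x∈⁅x⁆ x)

  ReachOnce⇒Reach : x ∈ S → ReachOnce S x y → Reach G S x y
  ReachOnce⇒Reach x∈S (inj₁ refl)          = here x∈S
  ReachOnce⇒Reach x∈S (inj₂ (_ , a , r)) = step x∈S a (Reach-mono (p─q⊆p _ _) r)

  reach? : ∀ m S → ∣ S ∣ < m → ∀ x y → Dec (Reach G S x y)
  reach? (suc m) S (s≤s |S|≤m) x y with x ∈? S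
  ... | no x∉S  = no (x∉S ∘ Reach-start)
  ... | yes x∈S = map′ (ReachOnce⇒Reach x∈S) Reach⇒ReachOnce
    (x ≟ y ⊎-dec any? λ z → (1 ≤? mult G x z) ×-dec reach? m (S - x) |S-x|<m z y)
    where
    |S-x|<m : ∣ S - x ∣ < m
    |S-x|<m = <-≤-trans (x∈p⇒∣p-x∣<∣p∣ x∈S) |S|≤m

  Reach? : ∀ S x y → Dec (Reach G S x y)
  Reach? S = reach? (suc n) S (s≤s (∣p∣≤n S))

  componentOf : Subset n → Fin n → Subset n
  componentOf S x = select (Reach? S x)

  Reach⇒∈componentOf : Reach G S x y → y ∈ componentOf S x
  Reach⇒∈componentOf {S} {x} = Equivalence.from (∈-select (Reach? S x))

  componentOf-Component : x ∈ S → Component G S (componentOf S x)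
  componentOf-Component {x} {S} x∈S =
    x , x∈S , λ y → Equivalence.to (∈-select (Reach? S x)) , Reach⇒∈componentOf

  Component-closed : Component G S C → x ∈ C → Reach G S x y → y ∈ C
  Component-closed (c , _ , c↝) x∈C x↝y = proj₂ (c↝ _) (Reach-trans (proj₁ (c↝ _) x∈C) x↝y)

  Component-connected : Component G S C → x ∈ C → y ∈ C → Reach G S x y
  Component-connected (c , _ , c↝) x∈C y∈C = Reach-trans (Reach-sym (proj₁ (c↝ _) x∈C)) (proj₁ (c↝ _) y∈C)

  Component-⊆ : Component G S C → C ⊆ S
  Component-⊆ comp x∈C = Reach-end (Component-connected comp x∈C x∈C)

  Component-connected-in : Component G S C → C ⊆ T → x ∈ C → y ∈ C → Reach G T x y
  Component-connected-in comp C⊆T x∈C y∈C =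
    Reach-restrict (C⊆T ∘ Component-closed comp x∈C) (Component-connected comp x∈C y∈C)

  Component-unique : Component G S C → Component G S D → x ∈ C → x ∈ D → C ≡ D
  Component-unique C-comp D-comp x∈C x∈D = ⊆-antisym
    (Component-closed D-comp x∈D ∘ Component-connected C-comp x∈C)
    (Component-closed C-comp x∈C ∘ Component-connected D-comp x∈D)

  CycleIn-mono : S ⊆ T → CycleIn G S x xs → CycleIn G T x xs
  CycleIn-mono S⊆T cyc = record
    { nontrivial = nontrivial
    ; distinct   = distinct
    ; inside     = All-map S⊆T inside
    ; closedWalk = closedWalk
    ; twoCycle   = twoCycle
    }
    where open CycleIn cyc

  CycleIn⇒two-vertices : CycleIn G S x xs → ∃ λ y → x ≢ y × x ∈ S × y ∈ S
  CycleIn⇒two-vertices {xs = []} cyc with () ← CycleIn.nontrivial cyc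
  CycleIn⇒two-vertices {xs = y ∷ _} cyc
    with (x≢y ∷ _) ∷ _ ← CycleIn.distinct cyc | x∈S ∷ y∈S ∷ _ ← CycleIn.inside cyc
    = y , x≢y , x∈S , y∈S

  triangle : x ≢ y → x ≢ z → y ≢ z → All (_∈ S) (x ∷ y ∷ z ∷ []) →
             Adj G x y → Adj G y z → Adj G z x → CycleIn G S x (y ∷ z ∷ [])
  triangle x≢y x≢z y≢z inside xy yz zx = record
    { nontrivial = s≤s z≤n
    ; distinct   = (x≢y ∷ x≢z ∷ []) ∷ (y≢z ∷ []) ∷ [] ∷ []
    ; inside     = inside
    ; closedWalk = xy ∷ yz ∷ zx ∷ [-]
    ; twoCycle   = λ _ ()
    }

  IsClique⇒Adj : IsClique G C → x ∈ C → y ∈ C → x ≢ y → Adj G x y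
  IsClique⇒Adj clique x∈C y∈C x≢y = ≤-reflexive (≡.sym (clique _ _ x∈C y∈C x≢y))

  CliquesOrTrees : Subset n → Set
  CliquesOrTrees S = ∀ C → Component G S C → IsClique G C ⊎ IsTree G C

  nontree-neighbour-component⇒¬CliquesOrTrees :
    ∀ {B u v} → (∀ x xs → CycleIn G (∁ B) x xs → v ∉ₗ (x ∷ xs)) → v ∉ B →
    Component G (∁ (⁅ v ⁆ ∪ B)) C → u ∈ C → Adj G v u → ¬ IsTree G C →
    v ∈ T → C ⊆ T → ¬ CliquesOrTrees T
  nontree-neighbour-component⇒¬CliquesOrTrees {C} {T} {B} {u} {v}
    noCycle v∉B C-comp u∈C v~u C-nontree v∈T C⊆T cliquesOrTrees =
    C-nontree λ _ _ cyc → refute cyc (cliquesOrTrees K K-comp)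
    where
    K = componentOf T v
    K-comp = componentOf-Component v∈T
    v∈K : v ∈ K
    v∈K = Reach⇒∈componentOf (here v∈T)
    C⊆K : C ⊆ K
    C⊆K y∈C = Reach⇒∈componentOf (step v∈T v~u (Component-connected-in C-comp C⊆T u∈C y∈C))
    C-avoids : ∀ {y} → y ∈ C → y ∉ ⁅ v ⁆ ∪ B
    C-avoids = x∈∁p⇒x∉p ∘ Component-⊆ C-comp
    v≢ : ∀ {y} → y ∈ C → v ≢ y
    v≢ y∈C refl = C-avoids y∈C (x∈p∪q⁺ (inj₁ (x∈⁅x⁆ v)))
    ∉B : ∀ {y} → y ∈ C → y ∈ ∁ B
    ∉B y∈C = x∉p⇒x∈∁p (C-avoids y∈C ∘ x∈p∪q⁺ ∘ inj₂)
    refute : ∀ {x xs} → CycleIn G C x xs → ¬ (IsClique G K ⊎ IsTree G K)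
    refute cyc (inj₂ K-tree) = K-tree _ _ (CycleIn-mono C⊆K cyc)
    refute cyc (inj₁ K-clique) with y , x≢y , x∈C , y∈C ← CycleIn⇒two-vertices cyc =
      noCycle v (_ ∷ y ∷ []) v-triangle (here refl)
      where
      edge : ∀ {a b} → a ∈ K → b ∈ K → a ≢ b → Adj G a b
      edge = IsClique⇒Adj K-clique
      v-triangle = triangle (v≢ x∈C) (v≢ y∈C) x≢y (x∉p⇒x∈∁p v∉B ∷ ∉B x∈C ∷ ∉B y∈C ∷ [])
        (edge v∈K (C⊆K x∈C) (v≢ x∈C)) (edge (C⊆K x∈C) (C⊆K y∈C) x≢y) (edge (C⊆K y∈C) v∈K (≢-sym (v≢ y∈C)))

  YesInstance-delete : ∀ {X k v} → v ∈ X → X ⊆ S → ∣ X ∣ ≤ suc k → CliquesOrTrees (S ─ X) →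
                       YesInstance G (S - v) k
  YesInstance-delete {S} {X} {v = v} v∈X X⊆S |X|≤1+k cliquesOrTrees =
    X - v , ─-monoˡ ⁅ v ⁆ X⊆S , ≤-pred (≤-trans (x∈p⇒∣p-x∣<∣p∣ v∈X) |X|≤1+k) ,
    subst CliquesOrTrees (≡.sym same-rest) cliquesOrTrees
    where
    open ≡-Reasoning
    same-rest : (S - v) ─ (X - v) ≡ S ─ X
    same-rest = begin
      S ─ ⁅ v ⁆ ─ (X - v)   ≡⟨ p─q─r≡p─q∪r S ⁅ v ⁆ (X - v) ⟩
      S ─ (⁅ v ⁆ ∪ (X - v)) ≡⟨ cong (S ─_) (p⊆q⇒p∪[q─p]≡q (x∈p⇒⁅x⁆⊆p v∈X)) ⟩
      S ─ X                 ∎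

  YesInstance-insert : ∀ {k v} → v ∈ S → YesInstance G (S - v) k → YesInstance G S (suc k)
  YesInstance-insert {S} {k} {v} v∈S (X , X⊆S-v , |X|≤k , cliquesOrTrees) =
    ⁅ v ⁆ ∪ X , ⁅v⁆∪X⊆S , |⁅v⁆∪X|≤1+k , subst CliquesOrTrees (p─q─r≡p─q∪r S ⁅ v ⁆ X) cliquesOrTrees
    where
    ⁅v⁆∪X⊆S : ⁅ v ⁆ ∪ X ⊆ S
    ⁅v⁆∪X⊆S = [ x∈p⇒⁅x⁆⊆p v∈S , p─q⊆p S ⁅ v ⁆ ∘ X⊆S-v ] ∘ x∈p∪q⁻ ⁅ v ⁆ X
    open ≤-Reasoning
    |⁅v⁆∪X|≤1+k : ∣ ⁅ v ⁆ ∪ X ∣ ≤ suc k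
    |⁅v⁆∪X|≤1+k = begin
      ∣ ⁅ v ⁆ ∪ X ∣       ≤⟨ ∣p∪q∣≤∣p∣+∣q∣ ⁅ v ⁆ X ⟩
      ∣ ⁅ v ⁆ ∣ + ∣ X ∣   ≡⟨ cong (_+ ∣ X ∣) (∣⁅x⁆∣≡1 v) ⟩
      suc ∣ X ∣           ≤⟨ s≤s |X|≤k ⟩
      suc k               ∎

lemma9 : ∀ {n} (G : Graph n) (k : ℕ) (v : Fin n) → 1 ≤ k → LargeSparse G k v →
    (B : Subset n) → v ∉ B → ∣ B ∣ ≤ 2 * k →
    (∀ x xs → CycleIn G (∁ B) x xs → v ∉ₗ (x ∷ xs)) →
    (comps : Fin (suc k) → Subset n) → Injective _≡_ _≡_ comps →
    (∀ i → Component G (∁ (⁅ v ⁆ ∪ B)) (comps i)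
           × Σ (Fin n) (λ u → u ∈ comps i × Adj G v u)
           × ¬ IsTree G (comps i)) →
    YesInstance G ⊤ k ⇔ YesInstance G (⊤ - v) (k ∸ 1)
lemma9 G (suc k) v (s≤s z≤n) _ B v∉B _ noCycle comps comps-injective comps-spec =
  mk⇔ (λ (X , _ , |X|≤ , ok) → YesInstance-delete G (solution∋v |X|≤ ok) ⊆⊤ |X|≤ ok)
      (YesInstance-insert G ∈⊤)
  where
  comps-disjoint : ∀ {i j x} → x ∈ comps i → x ∈ comps j → i ≡ j
  comps-disjoint x∈i x∈j =
    comps-injective (Component-unique G (proj₁ (comps-spec _)) (proj₁ (comps-spec _)) x∈i x∈j)

  solution∋v : ∀ {X} → ∣ X ∣ ≤ suc k → CliquesOrTrees G (⊤ ─ X) → v ∈ X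
  solution∋v {X} |X|≤ ok with v ∈? X
  ... | yes v∈X = v∈X
  ... | no v∉X =
    let (i , Cᵢ∩X-empty) = disjoint-family⇒∃-missed comps comps-disjoint (s≤s |X|≤)
        (Cᵢ-comp , (u , u∈Cᵢ , v~u) , Cᵢ-nontree) = comps-spec i
        Cᵢ⊆⊤─X : comps i ⊆ ⊤ ─ X
        Cᵢ⊆⊤─X = λ y∈Cᵢ → x∈p∧x∉q⇒x∈p─q ∈⊤ (λ y∈X → Cᵢ∩X-empty (_ , x∈p∩q⁺ (y∈Cᵢ , y∈X)))
    in ⊥-elim (nontree-neighbour-component⇒¬CliquesOrTrees G noCycle v∉B Cᵢ-comp u∈Cᵢ v~u Cᵢ-nontree
                 (x∈p∧x∉q⇒x∈p─q ∈⊤ v∉X) Cᵢ⊆⊤─X ok)
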